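{- Let $G=(V,E)$ be a finite simple undirected graph (not necessarily connected), and let $G^*$ be the cone of $G$. Then the number $|\mathcal{R}(G)|$ of relaxed legal configurations on $G$ equals the number $\tau(G^*)$ of spanning trees of $G^*$.
   Context: A (chip) configuration on a graph $G=(V,E)$ is a function $C\colon V\to\mathbb{N}$. A vertex $v$ can fire if $C(v)>\deg_G(v)$; firing $v$ replaces $C$ by $C'$ with $C'(v)=C(v)-\deg_G(v)-1$, $C'(u)=C(u)+1$ for every neighbor $u$ of $v$, and $C'(u)=C(u)$ otherwise (one chip goes to each neighbor and one chip is annihilated). A configuration is relaxed if no vertex can fire, i.e. $C(v)\le \deg_G(v)$ for all $v$. A configuration is supercritical if $C(v)>\deg_G(v)$ for every vertex $v$. Reverse-firing a vertex $v$ in a configuration $C'$ is allowed only when every neighbor $u$ of $v$ has $C'(u)\ge 1$, and produces $C$ with $C(v)=C'(v)+\deg_G(v)+1$, $C(u)=C'(u)-1$ for each neighbor $u$ of $v$, and $C(u)=C'(u)$ otherwise. A configuration $C$ is legal if there is a sequence of reverse-firings starting at $C$ and ending at a supercritical configuration. $\mathcal{R}(G)$ denotes the set of relaxed legal configurations on $G$. The cone $G^*$ is obtained from $G$ by adding a new vertex $x$ adjacent to every vertex of $G$. -}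

module Defs where

open import Data.Nat using (ℕ; zero; suc; _+_; _*_; _∸_; _≤_; _<_)
open import Data.Bool using (Bool; true; false; if_then_else_)
open import Data.Fin using (Fin; zero; suc; _≟_)
open import Data.Vec using (Vec; lookup; tabulate)
open import Data.List using (List; length)
open import Data.List.Membership.Propositional using (_∈_)
open import Data.List.Relation.Unary.Unique.Propositional using (Unique)
open import Data.Product using (Σ; _×_; ∃-syntax)
open import Relation.Binary.PropositionalEquality using (_≡_)
open import Relation.Binary.Construct.Closure.ReflexiveTransitive using (Star)
open import Relation.Nullary using (¬_; does)
open import Function.Bundles using (_⇔_)

Σ-fin : (n : ℕ) → (Fin n → ℕ) → ℕ
Σ-fin zero    f = 0
Σ-fin (suc n) f = f zero + Σ-fin n (λ i → f (suc i))

b2n : Bool → ℕ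
b2n true  = 1
b2n false = 0

record SimpleGraph (n : ℕ) : Set where
  field
    adj   : Fin n → Fin n → Bool
    sym   : ∀ i j → adj i j ≡ adj j i
    irrefl : ∀ i → adj i i ≡ false
open SimpleGraph public

deg : ∀ {n} → SimpleGraph n → Fin n → ℕ
deg G v = Σ-fin _ (λ u → b2n (adj G v u))

Config : ℕ → Set
Config n = Vec ℕ n

CanFire : ∀ {n} → SimpleGraph n → Config n → Fin n → Set
CanFire G C v = deg G v < lookup C v

Relaxed : ∀ {n} → SimpleGraph n → Config n → Set
Relaxed G C = ∀ v → ¬ CanFire G C v

Supercritical : ∀ {n} → SimpleGraph n → Config n → Set
Supercritical G C = ∀ v → deg G v < lookup C v

revFire : ∀ {n} → SimpleGraph n → Config n → Fin n → Config n
revFire G C v = tabulate λ u →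
  if does (u ≟ v) then lookup C v + deg G v + 1
  else (if adj G v u then lookup C u ∸ 1 else lookup C u)

RevStep : ∀ {n} → SimpleGraph n → Config n → Config n → Set
RevStep G C D = Σ (Fin _) λ v →
  (∀ u → adj G v u ≡ true → 1 ≤ lookup C u) × (D ≡ revFire G C v)

Legal : ∀ {n} → SimpleGraph n → Config n → Set
Legal G C = ∃[ D ] (Star (RevStep G) C D × Supercritical G D)

RelaxedLegal : ∀ {n} → SimpleGraph n → Config n → Set
RelaxedLegal G C = Relaxed G C × Legal G C

-- Cone G* on Fin (suc n): the new vertex x is `zero`, and vertex v of G
-- is `suc v`.

coneAdj : ∀ {n} → SimpleGraph n → Fin (suc n) → Fin (suc n) → Bool
coneAdj G zero    zero    = false
coneAdj G zero    (suc j) = true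
coneAdj G (suc i) zero    = true
coneAdj G (suc i) (suc j) = adj G i j

EdgeSet : ℕ → Set
EdgeSet m = Vec (Vec Bool m) m

tadj : ∀ {m} → EdgeSet m → Fin m → Fin m → Bool
tadj T i j = lookup (lookup T i) j

-- number of (unordered) edges, counted as ordered pairs = 2 · |E(T)|
orderedEdgeCount : ∀ {m} → EdgeSet m → ℕ
orderedEdgeCount {m} T = Σ-fin m λ i → Σ-fin m λ j → b2n (tadj T i j)

IsSpanningTree : ∀ {m} → (Fin m → Fin m → Bool) → EdgeSet m → Set
IsSpanningTree {m} A T =
    (∀ i j → tadj T i j ≡ tadj T j i)
  × (∀ i → tadj T i i ≡ false)
  × (∀ i j → tadj T i j ≡ true → A i j ≡ true)
  × (∀ i j → Star (λ a b → tadj T a b ≡ true) i j)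
  × (orderedEdgeCount T ≡ 2 * (m ∸ 1))

HasCard : {A : Set} → (A → Set) → ℕ → Set
HasCard {A} P k = Σ (List A) λ L →
  Unique L × (∀ x → (x ∈ L) ⇔ P x) × (length L ≡ k)

NumSpanningTrees : ∀ {m} → (Fin m → Fin m → Bool) → ℕ → Set
NumSpanningTrees A k = HasCard (IsSpanningTree A) k

{-# OPTIONS --safe #-}
-- Dhar's burning criterion: C is legal iff every nonempty vertex set S contains a vertex v with
-- at most C(v) neighbours in S.  A set violating this (a forbidden set) survives every reverse
-- firing, so no supercritical configuration is reachable; conversely, reverse-firing all
-- vertices once in a burning order adds one chip everywhere.  For relaxed C the criterion says
-- that deg - C is a parking function of G with respect to the apex of the cone.
-- Parking functions and spanning trees of G plus a sink joined to v by s(v) parallel edges obey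
-- the same deletion-contraction recursion at a sink edge, so they are equinumerous.  A spanning
-- tree is encoded by its parent map towards the sink and a rank function certifying acyclicity;
-- for a spanning tree of the cone, breadth-first levels provide the rank.
module Submission where

open import Defs renaming (sym to adj-sym; irrefl to adj-irrefl)

open import Algebra.Properties.CommutativeSemigroup using (interchange)
open import Data.Bool as Bool using (Bool; true; false; _∧_; _∨_; not; if_then_else_)
open import Data.Bool.Properties using (∧-zeroʳ; ∧-identityʳ; ∨-comm)
open import Data.Empty using (⊥; ⊥-elim)
open import Data.Fin as Fin using (Fin; zero; suc; _≟_; punchIn; punchOut)
open import Data.Fin.Properties using (any?; punchInᵢ≢i; punchIn-injective; punchIn-punchOut; punchOut-punchIn)
open import Data.List using (List; []; _∷_; map; _++_)
open import Data.List.Membership.Propositional using (_∈_)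
open import Data.List.Membership.Propositional.Properties using (∈-map⁺; ∈-map⁻; ∈-++⁺ˡ; ∈-++⁺ʳ; ∈-++⁻)
open import Data.List.Properties using (length-map; length-++)
open import Data.List.Relation.Unary.All as All using (All; []; _∷_)
import Data.List.Relation.Unary.All.Properties as All
open import Data.List.Relation.Unary.Any using (here)
open import Data.List.Relation.Unary.Unique.Propositional using (Unique; []; _∷_)
import Data.List.Relation.Unary.Unique.Propositional.Properties as Unique
open import Data.Nat as ℕ using (ℕ; zero; suc; pred; _+_; _*_; _∸_; _≤_; _<_; _≤?_; _<?_; z≤n; s≤s; z<s)
open import Data.Nat.Properties hiding (_≟_)
open import Data.Nat.Tactic.RingSolver using (solve-∀)
open import Data.Product using (Σ; _×_; _,_; proj₁; proj₂; ∃)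
open import Data.Sum using (_⊎_; inj₁; inj₂; [_,_])
open import Data.Sum.Properties using (inj₁-injective; inj₂-injective; ≡-dec)
open import Data.Unit using (⊤; tt)
open import Data.Vec as Vec using (Vec; []; lookup; tabulate)
open import Data.Vec.Properties
  using ( tabulate∘lookup; tabulate-cong; lookup∘tabulate; lookup-map; map-cong; map-id; map-∘
        ; lookup∘updateAt; lookup∘updateAt′; updateAt-updateAt; updateAt-updateAt-local; updateAt-id
        ; insertAt-lookup; insertAt-punchIn; removeAt-punchOut; removeAt-insertAt; insertAt-removeAt )
import Data.Vec.Functional as F
import Data.Vec.Functional.Properties as F
open import Function using (_∘_)
open import Function.Bundles using (mk⇔; Equivalence)
open import Relation.Binary.Construct.Closure.ReflexiveTransitive using (Star; ε; _◅_; _◅◅_; reverse)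
open import Relation.Binary.PropositionalEquality hiding ([_])
open import Relation.Nullary using (Dec; does; yes; no; ¬_)
open import Relation.Nullary.Decidable using (dec-true; dec-false; _×-dec_; _⊎-dec_)

private
  +-interchange : ∀ a b c d → (a + b) + (c + d) ≡ (a + c) + (b + d)
  +-interchange = interchange +-commutativeSemigroup

b2n-∧ : ∀ a b → b2n (a ∧ b) ≡ b2n a * b2n b
b2n-∧ true  b = sym (+-identityʳ (b2n b))
b2n-∧ false b = refl

Σ-fin-cong : ∀ n {f g : Fin n → ℕ} → (∀ i → f i ≡ g i) → Σ-fin n f ≡ Σ-fin n g
Σ-fin-cong zero    f≗g = refl
Σ-fin-cong (suc n) f≗g = cong₂ _+_ (f≗g zero) (Σ-fin-cong n (f≗g ∘ suc))

Σ-fin-distrib-+ : ∀ n (f g : Fin n → ℕ) →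
  Σ-fin n (λ i → f i + g i) ≡ Σ-fin n f + Σ-fin n g
Σ-fin-distrib-+ zero    f g = refl
Σ-fin-distrib-+ (suc n) f g =
  trans (cong (f zero + g zero +_) (Σ-fin-distrib-+ n (f ∘ suc) (g ∘ suc)))
        (+-interchange (f zero) (g zero) _ _)

Σ-fin-mono-≤ : ∀ n {f g : Fin n → ℕ} → (∀ i → f i ≤ g i) → Σ-fin n f ≤ Σ-fin n g
Σ-fin-mono-≤ zero    f≤g = z≤n
Σ-fin-mono-≤ (suc n) f≤g = +-mono-≤ (f≤g zero) (Σ-fin-mono-≤ n (f≤g ∘ suc))

Σ-fin-zero : ∀ n {f : Fin n → ℕ} → (∀ i → f i ≡ 0) → Σ-fin n f ≡ 0
Σ-fin-zero zero    f≗0 = refl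
Σ-fin-zero (suc n) f≗0 = cong₂ _+_ (f≗0 zero) (Σ-fin-zero n (f≗0 ∘ suc))

Σ-fin-const-1 : ∀ n → Σ-fin n (λ _ → 1) ≡ n
Σ-fin-const-1 zero    = refl
Σ-fin-const-1 (suc n) = cong suc (Σ-fin-const-1 n)

Σ-fin-punchIn : ∀ n (w : Fin (suc n)) (f : Fin (suc n) → ℕ) →
  Σ-fin (suc n) f ≡ f w + Σ-fin n (f ∘ punchIn w)
Σ-fin-punchIn n       zero    f = refl
Σ-fin-punchIn (suc n) (suc w) f = begin
  f zero + Σ-fin (suc n) (f ∘ suc)                      ≡⟨ cong (f zero +_) (Σ-fin-punchIn n w (f ∘ suc)) ⟩
  f zero + (f (suc w) + Σ-fin n (f ∘ suc ∘ punchIn w))  ≡⟨ +-comm (f zero) _ ⟩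
  f (suc w) + Σ-fin n (f ∘ suc ∘ punchIn w) + f zero    ≡⟨ +-assoc (f (suc w)) _ _ ⟩
  f (suc w) + (Σ-fin n (f ∘ suc ∘ punchIn w) + f zero)  ≡⟨ cong (f (suc w) +_) (+-comm _ (f zero)) ⟩
  f (suc w) + (f zero + Σ-fin n (f ∘ suc ∘ punchIn w))  ∎
  where open ≡-Reasoning

Σ-fin-swap : ∀ n m (f : Fin n → Fin m → ℕ) →
  Σ-fin n (λ i → Σ-fin m (f i)) ≡ Σ-fin m (λ j → Σ-fin n (λ i → f i j))
Σ-fin-swap zero    m f = sym (Σ-fin-zero m (λ _ → refl))
Σ-fin-swap (suc n) m f =
  trans (cong (Σ-fin m (f zero) +_) (Σ-fin-swap n m (f ∘ suc)))
        (sym (Σ-fin-distrib-+ m (f zero) (λ j → Σ-fin n (λ i → f (suc i) j))))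

term≤Σ-fin : ∀ n (f : Fin n → ℕ) i → f i ≤ Σ-fin n f
term≤Σ-fin (suc n) f zero    = m≤m+n (f zero) _
term≤Σ-fin (suc n) f (suc i) = ≤-trans (term≤Σ-fin n (f ∘ suc) i) (m≤n+m _ (f zero))

Σ-fin-select : ∀ n (i : Fin n) (f : Fin n → ℕ) →
  Σ-fin n (λ j → b2n (does (i ≟ j)) * f j) ≡ f i
Σ-fin-select (suc n) i f = begin
  Σ-fin (suc n) (λ j → δ j * f j)                     ≡⟨ Σ-fin-punchIn n i (λ j → δ j * f j) ⟩
  δ i * f i + Σ-fin n (λ j → δ (punchIn i j) * f (punchIn i j))
    ≡⟨ cong₂ _+_ (cong (_* f i) δ-diag) (Σ-fin-zero n (λ j → cong (_* f (punchIn i j)) (δ-off j))) ⟩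
  1 * f i + 0                                         ≡⟨ +-identityʳ (1 * f i) ⟩
  1 * f i                                             ≡⟨ *-identityˡ (f i) ⟩
  f i                                                 ∎
  where
  open ≡-Reasoning
  δ : Fin (suc n) → ℕ
  δ j = b2n (does (i ≟ j))
  δ-diag : δ i ≡ 1
  δ-diag with i ≟ i
  ... | yes _  = refl
  ... | no i≢i = ⊥-elim (i≢i refl)
  δ-off : ∀ j → δ (punchIn i j) ≡ 0
  δ-off j with i ≟ punchIn i j
  ... | yes i≡ = ⊥-elim (punchInᵢ≢i i j (sym i≡))
  ... | no _   = refl

Σ-fin-indicator : ∀ n (i : Fin n) → Σ-fin n (λ j → b2n (does (i ≟ j))) ≡ 1
Σ-fin-indicator n i =
  trans (Σ-fin-cong n (λ j → sym (*-identityʳ (b2n (does (i ≟ j)))))) (Σ-fin-select n i (λ _ → 1))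

Σ-fin-≤-≡⇒≡ : ∀ n {f g : Fin n → ℕ} → (∀ i → f i ≤ g i) → Σ-fin n f ≡ Σ-fin n g →
  ∀ i → f i ≡ g i
Σ-fin-≤-≡⇒≡ (suc n) {f} {g} f≤g Σ≡ = λ
  { zero    → proj₁ split
  ; (suc i) → Σ-fin-≤-≡⇒≡ n (f≤g ∘ suc) (proj₂ split) i }
  where
  +-≤-≡⇒≡ : ∀ {a b c d} → a ≤ b → c ≤ d → a + c ≡ b + d → a ≡ b × c ≡ d
  +-≤-≡⇒≡ {a} {c = c} {d} a≤b c≤d eq with m≤n⇒m<n∨m≡n a≤b
  ... | inj₁ a<b  = ⊥-elim (<⇒≢ (+-mono-<-≤ a<b c≤d) eq)
  ... | inj₂ refl = refl , +-cancelˡ-≡ a c d eq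
  split = +-≤-≡⇒≡ (f≤g zero) (Σ-fin-mono-≤ n (f≤g ∘ suc)) Σ≡

InjectiveOn : {A B : Set} → (A → Set) → (A → B) → Set
InjectiveOn P f = ∀ {a b} → P a → P b → f a ≡ f b → a ≡ b

Unique-map-injectiveOn : {A B : Set} {P : A → Set} {f : A → B} {L : List A} →
  InjectiveOn P f → All P L → Unique L → Unique (map f L)
Unique-map-injectiveOn inj []         []          = []
Unique-map-injectiveOn inj (pa ∷ pas) (a∉ ∷ uniq) =
  All.map⁺ (All.zipWith (λ (a≢b , pb) fa≡fb → a≢b (inj pa pb fa≡fb)) (a∉ , pas))
  ∷ Unique-map-injectiveOn inj pas uniq

HasCard-image : {A B : Set} {P : A → Set} {Q : B → Set} {k : ℕ} (f : A → B) →
  HasCard P k → InjectiveOn P f → (∀ a → P a → Q (f a)) →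
  (∀ b → Q b → Σ A λ a → P a × f a ≡ b) → HasCard Q k
HasCard-image {P = P} {Q} f (L , uniq , L⇔P , len) inj f-P→Q f-onto =
  map f L ,
  Unique-map-injectiveOn inj (All.tabulate (λ {a} → Equivalence.to (L⇔P a))) uniq ,
  (λ b → mk⇔ (member⇒Q b) (Q⇒member b)) ,
  trans (length-map f L) len
  where
  member⇒Q : ∀ b → b ∈ map f L → Q b
  member⇒Q b b∈ with ∈-map⁻ f b∈
  ... | a , a∈ , refl = f-P→Q a (Equivalence.to (L⇔P a) a∈)
  Q⇒member : ∀ b → Q b → b ∈ map f L
  Q⇒member b qb with f-onto b qb
  ... | a , pa , refl = ∈-map⁺ f (Equivalence.from (L⇔P a) pa)

HasCard-inverse : {A B : Set} {P : A → Set} {Q : B → Set} {k : ℕ} (f : A → B) (g : B → A) →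
  HasCard P k → (∀ a → P a → Q (f a)) → (∀ b → Q b → P (g b)) →
  (∀ a → P a → g (f a) ≡ a) → (∀ b → Q b → f (g b) ≡ b) → HasCard Q k
HasCard-inverse f g card-P f-P→Q g-Q→P gf≡id fg≡id =
  HasCard-image f card-P
    (λ {a} {b} pa pb fa≡fb → trans (sym (gf≡id a pa)) (trans (cong g fa≡fb) (gf≡id b pb)))
    f-P→Q
    (λ b qb → g b , g-Q→P b qb , fg≡id b qb)

HasCard-⊎ : {A B : Set} {P : A → Set} {Q : B → Set} {k l : ℕ} →
  HasCard P k → HasCard Q l → HasCard [ P , Q ] (k + l)
HasCard-⊎ {P = P} {Q} (L , uniq-L , L⇔P , len-L) (M , uniq-M , M⇔Q , len-M) =
  LM ,
  Unique.++⁺ (Unique.map⁺ inj₁-injective uniq-L) (Unique.map⁺ inj₂-injective uniq-M) disjoint ,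
  (λ x → mk⇔ (member⇒P⊎Q x) (P⊎Q⇒member x)) ,
  trans (length-++ (map inj₁ L)) (cong₂ _+_ (trans (length-map inj₁ L) len-L) (trans (length-map inj₂ M) len-M))
  where
  LM = map inj₁ L ++ map inj₂ M
  disjoint : ∀ {x} → x ∈ map inj₁ L × x ∈ map inj₂ M → ⊥
  disjoint (x∈L , x∈M) with ∈-map⁻ inj₁ x∈L | ∈-map⁻ inj₂ x∈M
  ... | _ , _ , refl | _ , _ , ()
  member⇒P⊎Q : ∀ x → x ∈ LM → [ P , Q ] x
  member⇒P⊎Q x x∈ with ∈-++⁻ (map inj₁ L) x∈
  ... | inj₁ x∈L with ∈-map⁻ inj₁ x∈L
  ...   | a , a∈ , refl = Equivalence.to (L⇔P a) a∈
  member⇒P⊎Q x x∈ | inj₂ x∈M with ∈-map⁻ inj₂ x∈M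
  ...   | b , b∈ , refl = Equivalence.to (M⇔Q b) b∈
  P⊎Q⇒member : ∀ x → [ P , Q ] x → x ∈ LM
  P⊎Q⇒member (inj₁ a) pa = ∈-++⁺ˡ (∈-map⁺ inj₁ (Equivalence.from (L⇔P a) pa))
  P⊎Q⇒member (inj₂ b) qb = ∈-++⁺ʳ (map inj₁ L) (∈-map⁺ inj₂ (Equivalence.from (M⇔Q b) qb))

HasCard-empty : {A : Set} {P : A → Set} → (∀ a → ¬ P a) → HasCard P 0
HasCard-empty ¬P = [] , [] , (λ a → mk⇔ (λ ()) (⊥-elim ∘ ¬P a)) , refl

HasCard-singleton : {A : Set} {P : A → Set} (a : A) → P a → (∀ b → b ≡ a) → HasCard P 1
HasCard-singleton a pa unique =
  a ∷ [] , [] ∷ [] , (λ b → mk⇔ (λ { (here refl) → pa }) (λ _ → here (unique b))) , refl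

VertexSet : ℕ → Set
VertexSet n = Fin n → Bool

NonEmpty : ∀ {n} → VertexSet n → Set
NonEmpty S = ∃ λ v → S v ≡ true

nonEmpty? : ∀ {n} (S : VertexSet n) → Dec (NonEmpty S)
nonEmpty? S = any? (λ v → S v Bool.≟ true)

¬nonEmpty⇒false : ∀ {n} (S : VertexSet n) → ¬ NonEmpty S → ∀ u → S u ≡ false
¬nonEmpty⇒false S empty u with S u in Su
... | true  = ⊥-elim (empty (u , Su))
... | false = refl

_─_ : ∀ {n} → VertexSet n → Fin n → VertexSet n
(S ─ v) u = S u ∧ not (does (v ≟ u))

─-⊆ : ∀ {n} (S : VertexSet n) v u → (S ─ v) u ≡ true → S u ≡ true
─-⊆ S v u S─v∋u with S u
... | true = refl

─-false : ∀ {n} (S : VertexSet n) v u → (S ─ v) u ≡ false → S u ≡ false ⊎ v ≡ u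
─-false S v u S─v∌u with S u | v ≟ u
... | false | _        = inj₁ refl
... | true  | yes v≡u  = inj₂ v≡u

─-self : ∀ {n} (S : VertexSet n) v → (S ─ v) v ≡ false
─-self S v with v ≟ v
... | yes _   = ∧-zeroʳ (S v)
... | no v≢v = ⊥-elim (v≢v refl)

b2n-─ : ∀ {n} (S : VertexSet n) v → S v ≡ true →
  ∀ u → b2n (S u) ≡ b2n ((S ─ v) u) + b2n (does (v ≟ u))
b2n-─ S v Sv u with v ≟ u
... | yes refl rewrite Sv = refl
... | no _     rewrite ∧-identityʳ (S u) = sym (+-identityʳ (b2n (S u)))

size : ∀ {n} → VertexSet n → ℕ
size {n} S = Σ-fin n (λ u → b2n (S u))

size-─ : ∀ {n} (S : VertexSet n) v → S v ≡ true → size S ≡ suc (size (S ─ v))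
size-─ {n} S v Sv = begin
  size S                                                     ≡⟨ Σ-fin-cong n (b2n-─ S v Sv) ⟩
  Σ-fin n (λ u → b2n ((S ─ v) u) + b2n (does (v ≟ u)))      ≡⟨ Σ-fin-distrib-+ n _ _ ⟩
  size (S ─ v) + Σ-fin n (λ u → b2n (does (v ≟ u)))          ≡⟨ cong (size (S ─ v) +_) (Σ-fin-indicator n v) ⟩
  size (S ─ v) + 1                                           ≡⟨ +-comm (size (S ─ v)) 1 ⟩
  suc (size (S ─ v))                                         ∎
  where open ≡-Reasoning

degIn : ∀ {n} → SimpleGraph n → VertexSet n → Fin n → ℕ
degIn {n} G S v = Σ-fin n (λ u → b2n (S u ∧ adj G v u))

degOut : ∀ {n} → SimpleGraph n → VertexSet n → Fin n → ℕ
degOut {n} G S v = Σ-fin n (λ u → b2n (not (S u) ∧ adj G v u))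

deg≡degIn+degOut : ∀ {n} (G : SimpleGraph n) S v → deg G v ≡ degIn G S v + degOut G S v
deg≡degIn+degOut {n} G S v = trans (Σ-fin-cong n split) (Σ-fin-distrib-+ n _ _)
  where
  split : ∀ u → b2n (adj G v u) ≡ b2n (S u ∧ adj G v u) + b2n (not (S u) ∧ adj G v u)
  split u with S u
  ... | true  = sym (+-identityʳ _)
  ... | false = refl

degIn≤deg : ∀ {n} (G : SimpleGraph n) S v → degIn G S v ≤ deg G v
degIn≤deg G S v = ≤-trans (m≤m+n _ _) (≤-reflexive (sym (deg≡degIn+degOut G S v)))

degIn-mono : ∀ {n} (G : SimpleGraph n) {T S : VertexSet n} v →
  (∀ u → T u ≡ true → S u ≡ true) → degIn G T v ≤ degIn G S v
degIn-mono {n} G {T} {S} v T⊆S = Σ-fin-mono-≤ n pointwise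
  where
  pointwise : ∀ u → b2n (T u ∧ adj G v u) ≤ b2n (S u ∧ adj G v u)
  pointwise u with T u in Tu
  ... | false = z≤n
  ... | true rewrite T⊆S u Tu = ≤-refl

degIn-─ : ∀ {n} (G : SimpleGraph n) (S : VertexSet n) v → S v ≡ true →
  ∀ u → degIn G S u ≡ degIn G (S ─ v) u + b2n (adj G u v)
degIn-─ {n} G S v Sv u = begin
  degIn G S u                                         ≡⟨ Σ-fin-cong n (λ x → b2n-∧ (S x) (adj G u x)) ⟩
  Σ-fin n (λ x → b2n (S x) * A x)                     ≡⟨ Σ-fin-cong n (λ x → cong (_* A x) (b2n-─ S v Sv x)) ⟩
  Σ-fin n (λ x → (b2n ((S ─ v) x) + δ x) * A x)
    ≡⟨ Σ-fin-cong n (λ x → *-distribʳ-+ (A x) (b2n ((S ─ v) x)) (δ x)) ⟩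
  Σ-fin n (λ x → b2n ((S ─ v) x) * A x + δ x * A x)  ≡⟨ Σ-fin-distrib-+ n _ _ ⟩
  Σ-fin n (λ x → b2n ((S ─ v) x) * A x) + Σ-fin n (λ x → δ x * A x)
    ≡⟨ cong₂ _+_ (Σ-fin-cong n (λ x → sym (b2n-∧ ((S ─ v) x) (adj G u x)))) (Σ-fin-select n v A) ⟩
  degIn G (S ─ v) u + A v                             ∎
  where
  open ≡-Reasoning
  A δ : Fin n → ℕ
  A x = b2n (adj G u x)
  δ x = b2n (does (v ≟ x))

-- Reverse firing and the burning criterion

Vec-ext : {A : Set} {n : ℕ} {xs ys : Vec A n} → (∀ i → lookup xs i ≡ lookup ys i) → xs ≡ ys
Vec-ext {xs = xs} {ys} xs≗ys =
  trans (sym (tabulate∘lookup xs)) (trans (tabulate-cong xs≗ys) (tabulate∘lookup ys))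

revFire-lookup : ∀ {n} (G : SimpleGraph n) C v u → lookup (revFire G C v) u ≡
  (if does (u ≟ v) then lookup C v + deg G v + 1
   else (if adj G v u then lookup C u ∸ 1 else lookup C u))
revFire-lookup G C v = lookup∘tabulate _

CanRevFire : ∀ {n} → SimpleGraph n → Config n → Fin n → Set
CanRevFire G C v = ∀ u → adj G v u ≡ true → 1 ≤ lookup C u

-- Reverse firing in conservative form, free of truncated subtraction.
revFire-conserves : ∀ {n} (G : SimpleGraph n) C v → CanRevFire G C v →
  ∀ u → lookup (revFire G C v) u + b2n (adj G v u) ≡ lookup C u + b2n (does (v ≟ u)) * (deg G u + 1)
revFire-conserves G C v fed u rewrite revFire-lookup G C v u with u ≟ v | v ≟ u
... | yes refl | no v≢v  = ⊥-elim (v≢v refl)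
... | no u≢v   | yes refl = ⊥-elim (u≢v refl)
... | yes refl | yes _ rewrite adj-irrefl G u = rearrange (lookup C u) (deg G u)
  where
  rearrange : ∀ c d → c + d + 1 + 0 ≡ c + 1 * (d + 1)
  rearrange = solve-∀
... | no _     | no _ with adj G v u in vu
...   | true  = trans (m∸n+n≡m (fed u vu)) (sym (+-identityʳ _))
...   | false = refl

revFire-conserves-other : ∀ {n} (G : SimpleGraph n) C v → CanRevFire G C v →
  ∀ u → u ≢ v → lookup (revFire G C v) u + b2n (adj G v u) ≡ lookup C u
revFire-conserves-other G C v fed u u≢v =
  trans (revFire-conserves G C v fed u)
        (trans (cong (λ b → lookup C u + b2n b * (deg G u + 1)) (dec-false (v ≟ u) (u≢v ∘ sym)))
               (+-identityʳ (lookup C u)))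

Forbidden : ∀ {n} → SimpleGraph n → Config n → VertexSet n → Set
Forbidden G C S = NonEmpty S × (∀ v → S v ≡ true → lookup C v < degIn G S v)

Burnable : ∀ {n} → SimpleGraph n → Config n → Set
Burnable G C = ∀ S → NonEmpty S → ∃ λ v → S v ≡ true × degIn G S v ≤ lookup C v

-- If the fired vertex x lies in S then S ─ x is forbidden afterwards, otherwise S itself is.
revStep-forbidden : ∀ {n} (G : SimpleGraph n) {C D} → RevStep G C D →
  ∀ S → Forbidden G C S → ∃ (Forbidden G D)
revStep-forbidden G {C} (x , fed , refl) S (S≠∅ , S-forbidden) with S x in Sx
... | false = S , S≠∅ , λ v Sv →
  ≤-trans (s≤s (m+n≤o⇒m≤o _ (≤-reflexive (revFire-conserves-other G C x fed v (x∉S v Sv)))))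
          (S-forbidden v Sv)
  where
  x∉S : ∀ v → S v ≡ true → v ≢ x
  x∉S v Sv refl with () ← trans (sym Sv) Sx
... | true = S ─ x , S─x≠∅ , λ v S─x∋v → +-cancelʳ-< _ _ _ (below v S─x∋v)
  where
  below : ∀ v → (S ─ x) v ≡ true →
    lookup (revFire G C x) v + b2n (adj G v x) < degIn G (S ─ x) v + b2n (adj G v x)
  below v S─x∋v = begin-strict
    lookup (revFire G C x) v + b2n (adj G v x)  ≡⟨ cong (λ b → lookup (revFire G C x) v + b2n b) (adj-sym G v x) ⟩
    lookup (revFire G C x) v + b2n (adj G x v)  ≡⟨ revFire-conserves-other G C x fed v v≢x ⟩
    lookup C v                                  <⟨ S-forbidden v (─-⊆ S x v S─x∋v) ⟩
    degIn G S v                                 ≡⟨ degIn-─ G S x Sx v ⟩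
    degIn G (S ─ x) v + b2n (adj G v x)         ∎
    where
    open ≤-Reasoning
    v≢x : v ≢ x
    v≢x refl with () ← trans (sym S─x∋v) (─-self S x)
  S─x≠∅ : NonEmpty (S ─ x)
  S─x≠∅ with nonEmpty? (S ─ x)
  ... | yes S─x≠∅ = S─x≠∅
  ... | no S─x=∅ = ⊥-elim (n≮0 (subst (lookup C x <_) degIn-x≡0 (S-forbidden x Sx)))
    where
    degIn-x≡0 : degIn G S x ≡ 0
    degIn-x≡0 = trans (degIn-─ G S x Sx x)
      (cong₂ _+_ (Σ-fin-zero _ (λ u → cong (λ b → b2n (b ∧ adj G x u)) (¬nonEmpty⇒false (S ─ x) S─x=∅ u)))
                 (cong b2n (adj-irrefl G x)))

revSteps-forbidden : ∀ {n} (G : SimpleGraph n) {C D} → Star (RevStep G) C D →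
  ∀ S → Forbidden G C S → ∃ (Forbidden G D)
revSteps-forbidden G ε              S S-forbidden = S , S-forbidden
revSteps-forbidden G (_◅_ {i = C} {j = C′} step steps) S S-forbidden
  with revStep-forbidden G {C} {C′} step S S-forbidden
... | S′ , S′-forbidden = revSteps-forbidden G steps S′ S′-forbidden

supercritical-¬forbidden : ∀ {n} (G : SimpleGraph n) {D} → Supercritical G D → ∀ S → ¬ Forbidden G D S
supercritical-¬forbidden G {D} super S ((v , Sv) , S-forbidden) =
  <-asym (S-forbidden v Sv) (≤-<-trans (degIn≤deg G S v) (super v))

legal⇒burnable : ∀ {n} (G : SimpleGraph n) C → Legal G C → Burnable G C
legal⇒burnable G C (D , steps , super) S S≠∅
  with any? (λ v → (S v Bool.≟ true) ×-dec (degIn G S v ≤? lookup C v))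
... | yes burning = burning
... | no none with revSteps-forbidden G {C} steps S (S≠∅ , λ v Sv → ≰⇒> (λ le → none (v , Sv , le)))
...   | S′ , S′-forbidden = ⊥-elim (supercritical-¬forbidden G {D} super S′ S′-forbidden)

_⊆ᵥ_ : ∀ {n} → VertexSet n → VertexSet n → Set
T ⊆ᵥ S = ∀ u → T u ≡ true → S u ≡ true

BurnableWithin : ∀ {n} → SimpleGraph n → Config n → VertexSet n → Set
BurnableWithin G C S = ∀ T → T ⊆ᵥ S → NonEmpty T → ∃ λ v → T v ≡ true × degIn G T v ≤ lookup C v

RevFiredOnce : ∀ {n} → SimpleGraph n → VertexSet n → Config n → Config n → Set
RevFiredOnce G S C D = ∀ u → lookup D u + degIn G S u ≡ lookup C u + b2n (S u) * (deg G u + 1)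

module RevFireLast {n} (G : SimpleGraph n) (S : VertexSet n) (v : Fin n) (Sv : S v ≡ true)
                   {C E : Config n} (fired : RevFiredOnce G (S ─ v) C E)
                   (outside : ∀ u → (S ─ v) u ≡ false → degIn G S u ≤ lookup C u) where

  canRevFire : CanRevFire G E v
  canRevFire u vu = positive (fired u) (below ((S ─ v) u) refl)
    where
    positive : ∀ {a b c} → a + b ≡ c → b < c → 1 ≤ a
    positive {zero} refl b<b = ⊥-elim (<-irrefl refl b<b)
    positive {suc a} _ _ = s≤s z≤n
    below : ∀ b → (S ─ v) u ≡ b → degIn G (S ─ v) u < lookup C u + b2n b * (deg G u + 1)
    below true  _ = begin-strict
      degIn G (S ─ v) u                      ≤⟨ degIn≤deg G (S ─ v) u ⟩
      deg G u                                <⟨ m<m+n (deg G u) z<s ⟩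
      deg G u + 1                            ≤⟨ m≤n+m _ (lookup C u) ⟩
      lookup C u + (deg G u + 1)             ≡⟨ cong (lookup C u +_) (sym (+-identityʳ _)) ⟩
      lookup C u + b2n true * (deg G u + 1)  ∎
      where open ≤-Reasoning
    below false S─v∌u = begin-strict
      degIn G (S ─ v) u                       <⟨ m<m+n _ z<s ⟩
      degIn G (S ─ v) u + 1
        ≡⟨ cong (λ b → degIn G (S ─ v) u + b2n b) (sym (trans (adj-sym G u v) vu)) ⟩
      degIn G (S ─ v) u + b2n (adj G u v)     ≡⟨ sym (degIn-─ G S v Sv u) ⟩
      degIn G S u                             ≤⟨ outside u S─v∌u ⟩
      lookup C u                              ≡⟨ sym (+-identityʳ _) ⟩
      lookup C u + b2n false * (deg G u + 1)  ∎
      where open ≤-Reasoning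

  fired-all : RevFiredOnce G S C (revFire G E v)
  fired-all u = begin
    F + degIn G S u                  ≡⟨ cong (F +_) (degIn-─ G S v Sv u) ⟩
    F + (degIn G (S ─ v) u + a)      ≡⟨ cong (λ b → F + (degIn G (S ─ v) u + b2n b)) (adj-sym G u v) ⟩
    F + (degIn G (S ─ v) u + a′)     ≡⟨ swapʳ F (degIn G (S ─ v) u) a′ ⟩
    F + a′ + degIn G (S ─ v) u       ≡⟨ cong (_+ degIn G (S ─ v) u) (revFire-conserves G E v canRevFire u) ⟩
    lookup E u + δ * k + degIn G (S ─ v) u      ≡⟨ swapˡ (lookup E u) (δ * k) (degIn G (S ─ v) u) ⟩
    lookup E u + degIn G (S ─ v) u + δ * k      ≡⟨ cong (_+ δ * k) (fired u) ⟩
    lookup C u + b2n ((S ─ v) u) * k + δ * k    ≡⟨ regroup (lookup C u) (b2n ((S ─ v) u)) δ k ⟩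
    lookup C u + (b2n ((S ─ v) u) + δ) * k      ≡⟨ cong (λ m → lookup C u + m * k) (sym (b2n-─ S v Sv u)) ⟩
    lookup C u + b2n (S u) * k                  ∎
    where
    open ≡-Reasoning
    F = lookup (revFire G E v) u
    a = b2n (adj G u v)
    a′ = b2n (adj G v u)
    δ = b2n (does (v ≟ u))
    k = deg G u + 1
    swapʳ : ∀ x y z → x + (y + z) ≡ x + z + y
    swapʳ = solve-∀
    swapˡ : ∀ x y z → x + y + z ≡ x + z + y
    swapˡ = solve-∀
    regroup : ∀ x y z w → x + y * w + z * w ≡ x + (y + z) * w
    regroup = solve-∀

-- Fire S ─ v first and a vertex v burnable in S last; a vertex outside S loses one chip per
-- neighbour in S, which the hypothesis on such vertices pays for.
revFireSet : ∀ {n} (G : SimpleGraph n) m S C → size S ≤ m → BurnableWithin G C S →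
  (∀ u → S u ≡ false → degIn G S u ≤ lookup C u) →
  ∃ λ D → Star (RevStep G) C D × RevFiredOnce G S C D
revFireSet G m S C size≤m burnable outside with nonEmpty? S
revFireSet {n} G m S C size≤m burnable outside | no S=∅ = C , ε , unchanged
  where
  S≡∅ = ¬nonEmpty⇒false S S=∅
  unchanged : RevFiredOnce G S C C
  unchanged u = cong₂ _+_ refl
    (trans (Σ-fin-zero n (λ x → cong (λ b → b2n (b ∧ adj G u x)) (S≡∅ x)))
           (cong (λ b → b2n b * (deg G u + 1)) (sym (S≡∅ u))))
revFireSet G zero S C size≤0 burnable outside | yes (v , Sv)
  with () ← subst (_≤ 0) (size-─ S v Sv) size≤0
revFireSet G (suc m) S C size≤m burnable outside | yes S≠∅
  with burnable S (λ _ Su → Su) S≠∅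
... | v , Sv , v-burns = revFire G E v , steps ◅◅ ((v , canRevFire , refl) ◅ ε) , fired-all
  where
  outside-─ : ∀ u → (S ─ v) u ≡ false → degIn G S u ≤ lookup C u
  outside-─ u S─v∌u with ─-false S v u S─v∌u
  ... | inj₁ S∌u = outside u S∌u
  ... | inj₂ refl = v-burns
  rest = revFireSet G m (S ─ v) C (≤-pred (subst (_≤ suc m) (size-─ S v Sv) size≤m))
           (λ T T⊆S─v → burnable T (λ u Tu → ─-⊆ S v u (T⊆S─v u Tu)))
           (λ u S─v∌u → ≤-trans (degIn-mono G u (─-⊆ S v)) (outside-─ u S─v∌u))
  E = proj₁ rest
  steps = proj₁ (proj₂ rest)
  open RevFireLast G S v Sv {C} {E} (proj₂ (proj₂ rest)) outside-─

addChips : ∀ {n} → Config n → ℕ → Config n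
addChips C k = Vec.map (_+ k) C

burnable-mono : ∀ {n} (G : SimpleGraph n) (C C′ : Config n) →
  (∀ u → lookup C u ≤ lookup C′ u) → Burnable G C → Burnable G C′
burnable-mono G C C′ C≤C′ burnable S S≠∅ with burnable S S≠∅
... | v , Sv , v-burns = v , Sv , ≤-trans v-burns (C≤C′ v)

burnable⇒revFire-all : ∀ {n} (G : SimpleGraph n) C → Burnable G C → Star (RevStep G) C (addChips C 1)
burnable⇒revFire-all {n} G C burnable
  with revFireSet G n (λ _ → true) C (≤-reflexive (Σ-fin-const-1 n)) (λ T _ → burnable T) (λ _ ())
... | D , steps , fired = subst (Star (RevStep G) C) (Vec-ext D≗C+1) steps
  where
  D≗C+1 : ∀ u → lookup D u ≡ lookup (addChips C 1) u
  D≗C+1 u = trans (+-cancelʳ-≡ (deg G u) _ _ (trans (fired u) (rearrange (lookup C u) (deg G u))))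
                  (sym (lookup-map u (_+ 1) C))
    where
    rearrange : ∀ c d → c + 1 * (d + 1) ≡ c + 1 + d
    rearrange = solve-∀

burnable⇒revFire-add : ∀ {n} (G : SimpleGraph n) C → Burnable G C → ∀ K → Star (RevStep G) C (addChips C K)
burnable⇒revFire-add G C burnable zero =
  subst (Star (RevStep G) C) (sym (trans (map-cong +-identityʳ C) (map-id C))) ε
burnable⇒revFire-add G C burnable (suc K) =
  burnable⇒revFire-add G C burnable K ◅◅
  subst (Star (RevStep G) (addChips C K)) addChips-suc (burnable⇒revFire-all G (addChips C K) burnable+K)
  where
  burnable+K : Burnable G (addChips C K)
  burnable+K = burnable-mono G C (addChips C K)
    (λ u → ≤-trans (m≤m+n (lookup C u) K) (≤-reflexive (sym (lookup-map u (_+ K) C)))) burnable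
  addChips-suc : addChips (addChips C K) 1 ≡ addChips C (suc K)
  addChips-suc = trans (sym (map-∘ (_+ 1) (_+ K) C))
                       (map-cong (λ c → trans (+-assoc c K 1) (cong (c +_) (+-comm K 1))) C)

burnable⇒legal : ∀ {n} (G : SimpleGraph n) C → Burnable G C → Legal G C
burnable⇒legal {n} G C burnable = addChips C K , burnable⇒revFire-add G C burnable K , supercritical
  where
  K = suc (Σ-fin n (deg G))
  supercritical : Supercritical G (addChips C K)
  supercritical v = begin-strict
    deg G v               ≤⟨ term≤Σ-fin n (deg G) v ⟩
    Σ-fin n (deg G)       <⟨ n<1+n _ ⟩
    K                     ≤⟨ m≤n+m K (lookup C v) ⟩
    lookup C v + K        ≡⟨ sym (lookup-map v (_+ K) C) ⟩
    lookup (addChips C K) v ∎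
    where open ≤-Reasoning

-- Parking functions

-- The sink is joined to each vertex v by s v parallel edges.
IsParking : ∀ {n} → SimpleGraph n → (Fin n → ℕ) → Vec ℕ n → Set
IsParking G s p = ∀ S → NonEmpty S → ∃ λ v → S v ≡ true × lookup p v < s v + degOut G S v

｛_｝ : ∀ {n} → Fin n → VertexSet n
｛ v ｝ u = does (v ≟ u)

degOut-｛｝ : ∀ {n} (G : SimpleGraph n) v → degOut G ｛ v ｝ v ≡ deg G v
degOut-｛｝ {n} G v = Σ-fin-cong n pointwise
  where
  pointwise : ∀ u → b2n (not (does (v ≟ u)) ∧ adj G v u) ≡ b2n (adj G v u)
  pointwise u with v ≟ u
  ... | yes refl rewrite adj-irrefl G v = refl
  ... | no _     = refl

parking-bounded : ∀ {n} (G : SimpleGraph n) s p → IsParking G s p → ∀ v → lookup p v < s v + deg G v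
parking-bounded G s p parking v with parking ｛ v ｝ (v , dec-true (v ≟ v) refl)
... | u , u∈｛v｝ , lt with v ≟ u
...   | yes refl = subst (λ d → lookup p v < s v + d) (degOut-｛｝ G v) lt

complement : ∀ {n} → SimpleGraph n → Vec ℕ n → Vec ℕ n
complement G c = tabulate (λ v → deg G v ∸ lookup c v)

complement-lookup : ∀ {n} (G : SimpleGraph n) c v → lookup (complement G c) v ≡ deg G v ∸ lookup c v
complement-lookup G c = lookup∘tabulate _

complement-involutive : ∀ {n} (G : SimpleGraph n) c → (∀ v → lookup c v ≤ deg G v) →
  complement G (complement G c) ≡ c
complement-involutive G c c≤deg = Vec-ext λ v →
  trans (complement-lookup G (complement G c) v)
        (trans (cong (deg G v ∸_) (complement-lookup G c v)) (m∸[m∸n]≡n (c≤deg v)))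

burns⇒parks : ∀ {n} (G : SimpleGraph n) S v c → degIn G S v ≤ c → deg G v ∸ c < 1 + degOut G S v
burns⇒parks G S v c degIn≤c = s≤s (begin
  deg G v ∸ c                           ≤⟨ ∸-monoʳ-≤ (deg G v) degIn≤c ⟩
  deg G v ∸ degIn G S v                 ≡⟨ cong (_∸ degIn G S v) (deg≡degIn+degOut G S v) ⟩
  degIn G S v + degOut G S v ∸ degIn G S v ≡⟨ m+n∸m≡n (degIn G S v) _ ⟩
  degOut G S v                          ∎)
  where open ≤-Reasoning

parks⇒burns : ∀ {n} (G : SimpleGraph n) S v p → p < 1 + degOut G S v → degIn G S v ≤ deg G v ∸ p
parks⇒burns G S v p (s≤s p≤degOut) = begin
  degIn G S v                            ≡⟨ sym (m+n∸n≡m (degIn G S v) (degOut G S v)) ⟩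
  degIn G S v + degOut G S v ∸ degOut G S v ≡⟨ cong (_∸ degOut G S v) (sym (deg≡degIn+degOut G S v)) ⟩
  deg G v ∸ degOut G S v                 ≤⟨ ∸-monoʳ-≤ (deg G v) p≤degOut ⟩
  deg G v ∸ p                            ∎
  where open ≤-Reasoning

one : ∀ {n} → Fin n → ℕ
one _ = 1

relaxedLegal⇒parking : ∀ {n} (G : SimpleGraph n) c → RelaxedLegal G c → IsParking G one (complement G c)
relaxedLegal⇒parking G c (_ , legal) S S≠∅ with legal⇒burnable G c legal S S≠∅
... | v , Sv , v-burns =
  v , Sv , subst (_< 1 + degOut G S v) (sym (complement-lookup G c v)) (burns⇒parks G S v (lookup c v) v-burns)

parking⇒relaxedLegal : ∀ {n} (G : SimpleGraph n) p → IsParking G one p → RelaxedLegal G (complement G p)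
parking⇒relaxedLegal G p parking = relaxed , burnable⇒legal G (complement G p) burnable
  where
  relaxed : Relaxed G (complement G p)
  relaxed v = ≤⇒≯ (≤-trans (≤-reflexive (complement-lookup G p v)) (m∸n≤m (deg G v) (lookup p v)))
  burnable : Burnable G (complement G p)
  burnable S S≠∅ with parking S S≠∅
  ... | v , Sv , parks =
    v , Sv , subst (degIn G S v ≤_) (sym (complement-lookup G p v)) (parks⇒burns G S v (lookup p v) parks)

relaxedLegal≈parking : ∀ {n} (G : SimpleGraph n) {k} → HasCard (IsParking G one) k → HasCard (RelaxedLegal G) k
relaxedLegal≈parking G card =
  HasCard-inverse (complement G) (complement G) card
    (parking⇒relaxedLegal G) (relaxedLegal⇒parking G)
    (λ p parking → complement-involutive G p (λ v → ≤-pred (parking-bounded G one p parking v)))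
    (λ c (relaxed , _) → complement-involutive G c (λ v → ≮⇒≥ (relaxed v)))

-- Deleting and contracting a sink edge

punchIn-view : ∀ {n} (w v : Fin (suc n)) → w ≡ v ⊎ ∃ λ v′ → punchIn w v′ ≡ v
punchIn-view w v with w ≟ v
... | yes w≡v = inj₁ w≡v
... | no w≢v  = inj₂ (punchOut w≢v , punchIn-punchOut w≢v)

lookup-removeAt : ∀ {A : Set} {n} (xs : Vec A (suc n)) w v → lookup (Vec.removeAt xs w) v ≡ lookup xs (punchIn w v)
lookup-removeAt xs w v =
  trans (cong (lookup (Vec.removeAt xs w)) (sym (punchOut-punchIn w))) (removeAt-punchOut xs (punchInᵢ≢i w v ∘ sym))

_⊖_ : ∀ {n} → SimpleGraph (suc n) → Fin (suc n) → SimpleGraph n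
G ⊖ w = record
  { adj    = λ i j → adj G (punchIn w i) (punchIn w j)
  ; sym    = λ i j → adj-sym G (punchIn w i) (punchIn w j)
  ; irrefl = λ i → adj-irrefl G (punchIn w i)
  }

-- Contracting the sink edge at w: the edges of w become sink edges of its neighbours.
mergeIntoSink : ∀ {n} → SimpleGraph (suc n) → (Fin (suc n) → ℕ) → Fin (suc n) → Fin n → ℕ
mergeIntoSink G s w v = s (punchIn w v) + b2n (adj G (punchIn w v) w)

dropSinkEdge : ∀ {n} → (Fin n → ℕ) → Fin n → Fin n → ℕ
dropSinkEdge s w = F.updateAt s w pred

degOut-cong : ∀ {n} (G : SimpleGraph n) {S T : VertexSet n} v → (∀ u → S u ≡ T u) → degOut G S v ≡ degOut G T v
degOut-cong {n} G v S≗T = Σ-fin-cong n (λ u → cong (λ b → b2n (not b ∧ adj G v u)) (S≗T u))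

degOut-⊖ : ∀ {n} (G : SimpleGraph (suc n)) (S : VertexSet (suc n)) w v → S w ≡ false →
  degOut G S (punchIn w v) ≡ b2n (adj G (punchIn w v) w) + degOut (G ⊖ w) (S ∘ punchIn w) v
degOut-⊖ {n} G S w v Sw rewrite Σ-fin-punchIn n w (λ u → b2n (not (S u) ∧ adj G (punchIn w v) u)) | Sw = refl

parking-shift : ∀ {n} (G : SimpleGraph n) s s′ p p′ →
  (∀ v → lookup p′ v + s v ≡ lookup p v + s′ v) → IsParking G s p → IsParking G s′ p′
parking-shift G s s′ p p′ shift parking S S≠∅ with parking S S≠∅
... | v , Sv , parks = v , Sv , +-cancelʳ-< (s v) (lookup p′ v) _ (begin-strict
  lookup p′ v + s v              ≡⟨ shift v ⟩
  lookup p v + s′ v              <⟨ +-monoˡ-< (s′ v) parks ⟩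
  s v + degOut G S v + s′ v      ≡⟨ rotate (s v) (degOut G S v) (s′ v) ⟩
  s′ v + degOut G S v + s v      ∎)
  where
  open ≤-Reasoning
  rotate : ∀ a b c → a + b + c ≡ c + b + a
  rotate = solve-∀

module ParkingRecursion {n} (G : SimpleGraph (suc n)) (s : Fin (suc n) → ℕ) (w : Fin (suc n))
                        {k} (sw≡1+k : s w ≡ suc k) where

  dropSinkEdge-w : dropSinkEdge s w w ≡ k
  dropSinkEdge-w = trans (F.updateAt-updates w s) (cong pred sw≡1+k)

  dropSinkEdge-other : ∀ v → w ≢ v → s v ≡ dropSinkEdge s w v
  dropSinkEdge-other v w≢v = sym (F.updateAt-minimal v w s (w≢v ∘ sym))

  Σ-fin-dropSinkEdge : Σ-fin (suc n) s ≡ suc (Σ-fin (suc n) (dropSinkEdge s w))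
  Σ-fin-dropSinkEdge = begin
    Σ-fin (suc n) s                                          ≡⟨ Σ-fin-cong (suc n) split ⟩
    Σ-fin (suc n) (λ v → dropSinkEdge s w v + δ v)           ≡⟨ Σ-fin-distrib-+ (suc n) (dropSinkEdge s w) δ ⟩
    Σ-fin (suc n) (dropSinkEdge s w) + Σ-fin (suc n) δ
      ≡⟨ cong (Σ-fin (suc n) (dropSinkEdge s w) +_) (Σ-fin-indicator (suc n) w) ⟩
    Σ-fin (suc n) (dropSinkEdge s w) + 1                     ≡⟨ +-comm _ 1 ⟩
    suc (Σ-fin (suc n) (dropSinkEdge s w))                   ∎
    where
    open ≡-Reasoning
    δ : Fin (suc n) → ℕ
    δ v = b2n (does (w ≟ v))
    split : ∀ v → s v ≡ dropSinkEdge s w v + δ v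
    split v with w ≟ v
    ... | yes refl = trans sw≡1+k (trans (+-comm 1 k) (cong (_+ 1) (sym dropSinkEdge-w)))
    ... | no w≢v   = trans (dropSinkEdge-other v w≢v) (sym (+-identityʳ _))

  parking-dropSinkEdge : ∀ p → 1 ≤ lookup p w → IsParking G s p →
    IsParking G (dropSinkEdge s w) (p Vec.[ w ]%= pred)
  parking-dropSinkEdge p 1≤pw = parking-shift G s (dropSinkEdge s w) p (p Vec.[ w ]%= pred) shift
    where
    shift : ∀ v → lookup (p Vec.[ w ]%= pred) v + s v ≡ lookup p v + dropSinkEdge s w v
    shift v with w ≟ v
    ... | no w≢v   = cong₂ _+_ (lookup∘updateAt′ v w (w≢v ∘ sym) p) (dropSinkEdge-other v w≢v)
    ... | yes refl = begin
      lookup (p Vec.[ w ]%= pred) w + s w  ≡⟨ cong₂ _+_ (lookup∘updateAt w p) sw≡1+k ⟩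
      pred (lookup p w) + suc k            ≡⟨ pred-+-suc (lookup p w) 1≤pw ⟩
      lookup p w + k                       ≡⟨ cong (lookup p w +_) (sym dropSinkEdge-w) ⟩
      lookup p w + dropSinkEdge s w w      ∎
      where
      open ≡-Reasoning
      pred-+-suc : ∀ a → 1 ≤ a → pred a + suc k ≡ a + k
      pred-+-suc (suc a) _ = +-suc a k

  parking-addSinkEdge : ∀ q → IsParking G (dropSinkEdge s w) q → IsParking G s (q Vec.[ w ]%= suc)
  parking-addSinkEdge q = parking-shift G (dropSinkEdge s w) s q (q Vec.[ w ]%= suc) shift
    where
    shift : ∀ v → lookup (q Vec.[ w ]%= suc) v + dropSinkEdge s w v ≡ lookup q v + s v
    shift v with w ≟ v
    ... | no w≢v   = cong₂ _+_ (lookup∘updateAt′ v w (w≢v ∘ sym) q) (sym (dropSinkEdge-other v w≢v))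
    ... | yes refl = begin
      lookup (q Vec.[ w ]%= suc) w + dropSinkEdge s w w  ≡⟨ cong₂ _+_ (lookup∘updateAt w q) dropSinkEdge-w ⟩
      suc (lookup q w) + k                               ≡⟨ sym (+-suc (lookup q w) k) ⟩
      lookup q w + suc k                                 ≡⟨ cong (lookup q w +_) (sym sw≡1+k) ⟩
      lookup q w + s w                                   ∎
      where open ≡-Reasoning

  parking-⊖ : ∀ p → IsParking G s p → IsParking (G ⊖ w) (mergeIntoSink G s w) (Vec.removeAt p w)
  parking-⊖ p parking S′ (u , S′u) with parking S (punchIn w u , trans (F.insertAt-punchIn S′ w false u) S′u)
    where S = F.insertAt S′ w false
  ... | v , Sv , parks with punchIn-view w v
  ...   | inj₁ refl with () ← trans (sym Sv) (F.insertAt-lookup S′ w false)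
  ...   | inj₂ (v′ , refl) = v′ , trans (sym (F.insertAt-punchIn S′ w false v′)) Sv , (begin-strict
    lookup (Vec.removeAt p w) v′   ≡⟨ lookup-removeAt p w v′ ⟩
    lookup p (punchIn w v′)        <⟨ parks ⟩
    s (punchIn w v′) + degOut G S (punchIn w v′)
      ≡⟨ cong (s (punchIn w v′) +_) (degOut-⊖ G S w v′ (F.insertAt-lookup S′ w false)) ⟩
    s (punchIn w v′) + (b2n (adj G (punchIn w v′) w) + degOut (G ⊖ w) (S ∘ punchIn w) v′)
      ≡⟨ sym (+-assoc (s (punchIn w v′)) _ _) ⟩
    mergeIntoSink G s w v′ + degOut (G ⊖ w) (S ∘ punchIn w) v′
      ≡⟨ cong (mergeIntoSink G s w v′ +_) (degOut-cong (G ⊖ w) v′ (F.insertAt-punchIn S′ w false)) ⟩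
    mergeIntoSink G s w v′ + degOut (G ⊖ w) S′ v′  ∎)
    where
    open ≤-Reasoning
    S = F.insertAt S′ w false

  parking-⊕ : ∀ q → IsParking (G ⊖ w) (mergeIntoSink G s w) q → IsParking G s (Vec.insertAt q w 0)
  parking-⊕ q parking S (u , Su) with S w in Sw
  ... | true = w , Sw , subst (_< s w + degOut G S w) (sym (insertAt-lookup q w 0))
                          (subst (λ m → 0 < m + degOut G S w) (sym sw≡1+k) z<s)
  ... | false with punchIn-view w u
  ...   | inj₁ refl with () ← trans (sym Su) Sw
  ...   | inj₂ (u′ , refl) with parking (S ∘ punchIn w) (u′ , Su)
  ...     | v′ , Sv′ , parks = punchIn w v′ , Sv′ , (begin-strict
    lookup (Vec.insertAt q w 0) (punchIn w v′)   ≡⟨ insertAt-punchIn q w 0 v′ ⟩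
    lookup q v′                                  <⟨ parks ⟩
    mergeIntoSink G s w v′ + degOut (G ⊖ w) (S ∘ punchIn w) v′  ≡⟨ +-assoc (s (punchIn w v′)) _ _ ⟩
    s (punchIn w v′) + (b2n (adj G (punchIn w v′) w) + degOut (G ⊖ w) (S ∘ punchIn w) v′)
      ≡⟨ cong (s (punchIn w v′) +_) (sym (degOut-⊖ G S w v′ Sw)) ⟩
    s (punchIn w v′) + degOut G S (punchIn w v′)  ∎)
    where open ≤-Reasoning

  splitParking : Vec ℕ (suc n) → Vec ℕ (suc n) ⊎ Vec ℕ n
  splitParking p with lookup p w
  ... | zero  = inj₂ (Vec.removeAt p w)
  ... | suc _ = inj₁ (p Vec.[ w ]%= pred)

  joinParking : Vec ℕ (suc n) ⊎ Vec ℕ n → Vec ℕ (suc n)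
  joinParking = [ (λ q → q Vec.[ w ]%= suc) , (λ q → Vec.insertAt q w 0) ]

  parking-recursion : ∀ {k₁ k₂} → HasCard (IsParking G (dropSinkEdge s w)) k₁ →
    HasCard (IsParking (G ⊖ w) (mergeIntoSink G s w)) k₂ → HasCard (IsParking G s) (k₁ + k₂)
  parking-recursion card₁ card₂ =
    HasCard-inverse joinParking splitParking (HasCard-⊎ card₁ card₂) join-parking split-parking split∘join join∘split
    where
    join-parking : ∀ x → [ IsParking G (dropSinkEdge s w) , IsParking (G ⊖ w) (mergeIntoSink G s w) ] x →
      IsParking G s (joinParking x)
    join-parking (inj₁ q) = parking-addSinkEdge q
    join-parking (inj₂ q) = parking-⊕ q
    split-parking : ∀ p → IsParking G s p →
      [ IsParking G (dropSinkEdge s w) , IsParking (G ⊖ w) (mergeIntoSink G s w) ] (splitParking p)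
    split-parking p parking with lookup p w in pw
    ... | zero  = parking-⊖ p parking
    ... | suc _ = parking-dropSinkEdge p (subst (1 ≤_) (sym pw) (s≤s z≤n)) parking
    split∘join : ∀ x → _ → splitParking (joinParking x) ≡ x
    split∘join (inj₁ q) _ rewrite lookup∘updateAt w {suc} q =
      cong inj₁ (trans (updateAt-updateAt w q) (updateAt-id w q))
    split∘join (inj₂ q) _ rewrite insertAt-lookup q w 0 = cong inj₂ (removeAt-insertAt q w 0)
    join∘split : ∀ p → IsParking G s p → joinParking (splitParking p) ≡ p
    join∘split p _ with lookup p w in pw
    ... | zero  = subst (λ x → Vec.insertAt (Vec.removeAt p w) w x ≡ p) pw (insertAt-removeAt p w)
    ... | suc _ = trans (updateAt-updateAt-local w p (trans (cong (λ (m : ℕ) → suc (pred m)) pw) (sym pw))) (updateAt-id w p)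

-- Sink trees

-- A spanning tree of G plus a sink joined to each v by s v parallel edges, oriented towards the
-- sink: v's parent is inj₁ u (an edge of G) or inj₂ j (the j-th sink edge at v).
ParentMap : ℕ → Set
ParentMap n = Vec (Fin n ⊎ ℕ) n

ValidParent : ∀ {n} → SimpleGraph n → (Fin n → ℕ) → Fin n → Fin n ⊎ ℕ → Set
ValidParent G s v (inj₁ u) = adj G v u ≡ true
ValidParent G s v (inj₂ j) = j < s v

RankDrops : ∀ {n} → (Fin n → ℕ) → Fin n → Fin n ⊎ ℕ → Set
RankDrops rank v (inj₁ u) = rank u < rank v
RankDrops rank v (inj₂ _) = ⊤

record IsSinkTree {n} (G : SimpleGraph n) (s : Fin n → ℕ) (π : ParentMap n) : Set where
  field
    valid      : ∀ v → ValidParent G s v (lookup π v)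
    rank       : Fin n → ℕ
    rank-drops : ∀ v → RankDrops rank v (lookup π v)

module SinkTreeRecursion {n} (G : SimpleGraph (suc n)) (s : Fin (suc n) → ℕ) (w : Fin (suc n))
                         {k} (sw≡1+k : s w ≡ suc k) where

  open ParkingRecursion G s w sw≡1+k using (dropSinkEdge-w; dropSinkEdge-other)

  valid-dropSinkEdge : ∀ v x → (w ≡ v → x ≢ inj₂ k) → ValidParent G s v x → ValidParent G (dropSinkEdge s w) v x
  valid-dropSinkEdge v (inj₁ u) _ vu = vu
  valid-dropSinkEdge v (inj₂ j) x≢k j<sv with w ≟ v
  ... | no w≢v   = subst (j <_) (dropSinkEdge-other v w≢v) j<sv
  ... | yes refl with m<1+n⇒m<n∨m≡n (subst (j <_) sw≡1+k j<sv)
  ...   | inj₁ j<k  = subst (j <_) (sym dropSinkEdge-w) j<k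
  ...   | inj₂ refl = ⊥-elim (x≢k refl refl)

  valid-addSinkEdge : ∀ v x → ValidParent G (dropSinkEdge s w) v x → ValidParent G s v x
  valid-addSinkEdge v (inj₁ u) vu = vu
  valid-addSinkEdge v (inj₂ j) j<s′v with w ≟ v
  ... | no w≢v   = subst (j <_) (sym (dropSinkEdge-other v w≢v)) j<s′v
  ... | yes refl = subst (j <_) (sym sw≡1+k) (m<n⇒m<1+n (subst (j <_) dropSinkEdge-w j<s′v))

  sinkTree-dropSinkEdge : ∀ π → lookup π w ≢ inj₂ k → IsSinkTree G s π → IsSinkTree G (dropSinkEdge s w) π
  sinkTree-dropSinkEdge π πw≢k tree = record
    { valid = λ v → valid-dropSinkEdge v (lookup π v) (λ { refl → πw≢k }) (valid v)
    ; rank = rank ; rank-drops = rank-drops }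
    where open IsSinkTree tree

  sinkTree-addSinkEdge : ∀ π → IsSinkTree G (dropSinkEdge s w) π → IsSinkTree G s π
  sinkTree-addSinkEdge π tree = record
    { valid = λ v → valid-addSinkEdge v (lookup π v) (valid v) ; rank = rank ; rank-drops = rank-drops }
    where open IsSinkTree tree

  sinkTree-dropSinkEdge-≢ : ∀ π → IsSinkTree G (dropSinkEdge s w) π → lookup π w ≢ inj₂ k
  sinkTree-dropSinkEdge-≢ π tree πw≡k =
    <-irrefl refl (subst (k <_) dropSinkEdge-w (subst (ValidParent G (dropSinkEdge s w) w) πw≡k (valid w)))
    where open IsSinkTree tree

  -- At v = punchIn w v′ the edge v–w becomes the sink edge numbered s v, the first new one.
  contractEntry : Fin n → Fin (suc n) ⊎ ℕ → Fin n ⊎ ℕ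
  contractEntry v′ (inj₁ u) with w ≟ u
  ... | yes _  = inj₂ (s (punchIn w v′))
  ... | no w≢u = inj₁ (punchOut w≢u)
  contractEntry v′ (inj₂ j) = inj₂ j

  expandEntry : Fin n → Fin n ⊎ ℕ → Fin (suc n) ⊎ ℕ
  expandEntry v′ (inj₁ u′) = inj₁ (punchIn w u′)
  expandEntry v′ (inj₂ j) with j <? s (punchIn w v′)
  ... | yes _ = inj₂ j
  ... | no _  = inj₁ w

  s′ = mergeIntoSink G s w

  contract-valid : ∀ v′ x → ValidParent G s (punchIn w v′) x → ValidParent (G ⊖ w) s′ v′ (contractEntry v′ x)
  contract-valid v′ (inj₁ u) vu with w ≟ u
  ... | yes refl = subst (λ b → s (punchIn w v′) < s (punchIn w v′) + b2n b) (sym vu) (m<m+n _ z<s)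
  ... | no w≢u   = subst (λ x → adj G (punchIn w v′) x ≡ true) (sym (punchIn-punchOut w≢u)) vu
  contract-valid v′ (inj₂ j) j<t = ≤-trans j<t (m≤m+n _ _)

  contract-rankDrops : ∀ rank v′ x → RankDrops rank (punchIn w v′) x →
    RankDrops (rank ∘ punchIn w) v′ (contractEntry v′ x)
  contract-rankDrops rank v′ (inj₁ u) drops with w ≟ u
  ... | yes _  = tt
  ... | no w≢u = subst (λ x → rank x < rank (punchIn w v′)) (sym (punchIn-punchOut w≢u)) drops
  contract-rankDrops rank v′ (inj₂ j) _ = tt

  expand-valid : ∀ v′ y → ValidParent (G ⊖ w) s′ v′ y → ValidParent G s (punchIn w v′) (expandEntry v′ y)
  expand-valid v′ (inj₁ u′) vu = vu
  expand-valid v′ (inj₂ j) j<s′v with j <? s (punchIn w v′)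
  ... | yes j<t = j<t
  ... | no j≮t with adj G (punchIn w v′) w
  ...   | true  = refl
  ...   | false = ⊥-elim (j≮t (subst (j <_) (+-identityʳ _) j<s′v))

  expand-rankDrops : ∀ rank′ v′ y → RankDrops rank′ v′ y →
    RankDrops (F.insertAt (suc ∘ rank′) w 0) (punchIn w v′) (expandEntry v′ y)
  expand-rankDrops rank′ v′ (inj₁ u′) drops
    rewrite F.insertAt-punchIn (suc ∘ rank′) w 0 u′ | F.insertAt-punchIn (suc ∘ rank′) w 0 v′ = s≤s drops
  expand-rankDrops rank′ v′ (inj₂ j) _ with j <? s (punchIn w v′)
  ... | yes _ = tt
  ... | no _ rewrite F.insertAt-lookup (suc ∘ rank′) w 0 | F.insertAt-punchIn (suc ∘ rank′) w 0 v′ = z<s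

  contract∘expand : ∀ v′ y → ValidParent (G ⊖ w) s′ v′ y → contractEntry v′ (expandEntry v′ y) ≡ y
  contract∘expand v′ (inj₁ u′) _ with w ≟ punchIn w u′
  ... | yes w≡ = ⊥-elim (punchInᵢ≢i w u′ (sym w≡))
  ... | no w≢  = cong inj₁ (punchIn-injective w _ u′ (punchIn-punchOut w≢))
  contract∘expand v′ (inj₂ j) j<s′v with j <? s (punchIn w v′)
  ... | yes _ = refl
  ... | no j≮t with w ≟ w
  ...   | no w≢w = ⊥-elim (w≢w refl)
  ...   | yes _  = cong inj₂ (≤-antisym (≮⇒≥ j≮t) (<+b2n⇒≤ (adj G (punchIn w v′) w) j<s′v))
    where
    <+b2n⇒≤ : ∀ {i t} b → i < t + b2n b → i ≤ t
    <+b2n⇒≤ {i} {t} true  i<t+1 = m<1+n⇒m≤n (subst (i <_) (+-comm t 1) i<t+1)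
    <+b2n⇒≤ {i} {t} false i<t+0 = <⇒≤ (subst (i <_) (+-identityʳ t) i<t+0)

  expand∘contract : ∀ v′ x → ValidParent G s (punchIn w v′) x → expandEntry v′ (contractEntry v′ x) ≡ x
  expand∘contract v′ (inj₁ u) _ with w ≟ u
  ... | no w≢u   = cong inj₁ (punchIn-punchOut w≢u)
  ... | yes refl with s (punchIn w v′) <? s (punchIn w v′)
  ...   | yes t<t = ⊥-elim (<-irrefl refl t<t)
  ...   | no _    = refl
  expand∘contract v′ (inj₂ j) j<t with j <? s (punchIn w v′)
  ... | yes _   = refl
  ... | no j≮t  = ⊥-elim (j≮t j<t)

  contractTree : ParentMap (suc n) → ParentMap n
  contractTree π = tabulate (λ v′ → contractEntry v′ (lookup π (punchIn w v′)))

  expandTree : ParentMap n → ParentMap (suc n)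
  expandTree π′ = Vec.insertAt (tabulate (λ v′ → expandEntry v′ (lookup π′ v′))) w (inj₂ k)

  contractTree-lookup : ∀ π v′ → lookup (contractTree π) v′ ≡ contractEntry v′ (lookup π (punchIn w v′))
  contractTree-lookup π = lookup∘tabulate _

  expandTree-w : ∀ π′ → lookup (expandTree π′) w ≡ inj₂ k
  expandTree-w π′ = insertAt-lookup _ w (inj₂ k)

  expandTree-punchIn : ∀ π′ v′ → lookup (expandTree π′) (punchIn w v′) ≡ expandEntry v′ (lookup π′ v′)
  expandTree-punchIn π′ v′ = trans (insertAt-punchIn _ w (inj₂ k) v′) (lookup∘tabulate _ v′)

  sinkTree-contract : ∀ π → IsSinkTree G s π → IsSinkTree (G ⊖ w) s′ (contractTree π)
  sinkTree-contract π tree = record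
    { valid      = λ v′ → subst (ValidParent (G ⊖ w) s′ v′) (sym (contractTree-lookup π v′))
                            (contract-valid v′ _ (valid (punchIn w v′)))
    ; rank       = rank ∘ punchIn w
    ; rank-drops = λ v′ → subst (RankDrops (rank ∘ punchIn w) v′) (sym (contractTree-lookup π v′))
                            (contract-rankDrops rank v′ _ (rank-drops (punchIn w v′)))
    }
    where open IsSinkTree tree

  sinkTree-expand : ∀ π′ → IsSinkTree (G ⊖ w) s′ π′ → IsSinkTree G s (expandTree π′)
  sinkTree-expand π′ tree = record { valid = valid′ ; rank = rank′ ; rank-drops = rank-drops′ }
    where
    open IsSinkTree tree
    rank′ = F.insertAt (suc ∘ rank) w 0
    valid′ : ∀ v → ValidParent G s v (lookup (expandTree π′) v)
    valid′ v with punchIn-view w v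
    ... | inj₁ refl = subst (ValidParent G s w) (sym (expandTree-w π′)) (≤-reflexive (sym sw≡1+k))
    ... | inj₂ (v′ , refl) = subst (ValidParent G s (punchIn w v′)) (sym (expandTree-punchIn π′ v′))
                               (expand-valid v′ _ (valid v′))
    rank-drops′ : ∀ v → RankDrops rank′ v (lookup (expandTree π′) v)
    rank-drops′ v with punchIn-view w v
    ... | inj₁ refl = subst (RankDrops rank′ w) (sym (expandTree-w π′)) tt
    ... | inj₂ (v′ , refl) = subst (RankDrops rank′ (punchIn w v′)) (sym (expandTree-punchIn π′ v′))
                               (expand-rankDrops rank v′ _ (rank-drops v′))

  contractTree∘expandTree : ∀ π′ → IsSinkTree (G ⊖ w) s′ π′ → contractTree (expandTree π′) ≡ π′
  contractTree∘expandTree π′ tree = Vec-ext λ v′ →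
    trans (contractTree-lookup (expandTree π′) v′)
          (trans (cong (contractEntry v′) (expandTree-punchIn π′ v′))
                 (contract∘expand v′ _ (IsSinkTree.valid tree v′)))

  expandTree∘contractTree : ∀ π → IsSinkTree G s π → lookup π w ≡ inj₂ k → expandTree (contractTree π) ≡ π
  expandTree∘contractTree π tree πw≡k = Vec-ext λ v → entry v (punchIn-view w v)
    where
    entry : ∀ v → w ≡ v ⊎ ∃ (λ v′ → punchIn w v′ ≡ v) →
      lookup (expandTree (contractTree π)) v ≡ lookup π v
    entry v (inj₁ refl) = trans (expandTree-w (contractTree π)) (sym πw≡k)
    entry v (inj₂ (v′ , refl)) =
      trans (expandTree-punchIn (contractTree π) v′)
            (trans (cong (expandEntry v′) (contractTree-lookup π v′))
                   (expand∘contract v′ _ (IsSinkTree.valid tree (punchIn w v′))))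

  splitTree : ParentMap (suc n) → ParentMap (suc n) ⊎ ParentMap n
  splitTree π with ≡-dec Fin._≟_ ℕ._≟_ (lookup π w) (inj₂ k)
  ... | yes _ = inj₂ (contractTree π)
  ... | no _  = inj₁ π

  joinTree : ParentMap (suc n) ⊎ ParentMap n → ParentMap (suc n)
  joinTree = [ (λ π → π) , expandTree ]

  sinkTree-recursion : ∀ {k₁ k₂} → HasCard (IsSinkTree G (dropSinkEdge s w)) k₁ →
    HasCard (IsSinkTree (G ⊖ w) s′) k₂ → HasCard (IsSinkTree G s) (k₁ + k₂)
  sinkTree-recursion card₁ card₂ =
    HasCard-inverse joinTree splitTree (HasCard-⊎ card₁ card₂) join-tree split-tree split∘join join∘split
    where
    join-tree : ∀ x → [ IsSinkTree G (dropSinkEdge s w) , IsSinkTree (G ⊖ w) s′ ] x → IsSinkTree G s (joinTree x)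
    join-tree (inj₁ π)  = sinkTree-addSinkEdge π
    join-tree (inj₂ π′) = sinkTree-expand π′
    split-tree : ∀ π → IsSinkTree G s π → [ IsSinkTree G (dropSinkEdge s w) , IsSinkTree (G ⊖ w) s′ ] (splitTree π)
    split-tree π tree with ≡-dec Fin._≟_ ℕ._≟_ (lookup π w) (inj₂ k)
    ... | yes _     = sinkTree-contract π tree
    ... | no πw≢k   = sinkTree-dropSinkEdge π πw≢k tree
    split∘join : ∀ x → [ IsSinkTree G (dropSinkEdge s w) , IsSinkTree (G ⊖ w) s′ ] x → splitTree (joinTree x) ≡ x
    split∘join (inj₁ π) tree with ≡-dec Fin._≟_ ℕ._≟_ (lookup π w) (inj₂ k)
    ... | yes πw≡k = ⊥-elim (sinkTree-dropSinkEdge-≢ π tree πw≡k)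
    ... | no _     = refl
    split∘join (inj₂ π′) tree with ≡-dec Fin._≟_ ℕ._≟_ (lookup (expandTree π′) w) (inj₂ k)
    ... | yes _    = cong inj₂ (contractTree∘expandTree π′ tree)
    ... | no ≢k    = ⊥-elim (≢k (expandTree-w π′))
    join∘split : ∀ π → IsSinkTree G s π → joinTree (splitTree π) ≡ π
    join∘split π tree with ≡-dec Fin._≟_ ℕ._≟_ (lookup π w) (inj₂ k)
    ... | yes πw≡k = expandTree∘contractTree π tree πw≡k
    ... | no _     = refl

Equinumerous : {A B : Set} → (A → Set) → (B → Set) → Set
Equinumerous P Q = ∃ λ k → HasCard P k × HasCard Q k

noSinkEdges-¬parking : ∀ {n} (G : SimpleGraph (suc n)) s → (∀ v → s v ≡ 0) → ∀ p → ¬ IsParking G s p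
noSinkEdges-¬parking {n} G s s≗0 p parking with parking (λ _ → true) (zero , refl)
... | v , _ , parks = n≮0 (subst (lookup p v <_) (cong₂ _+_ (s≗0 v) (Σ-fin-zero (suc n) (λ _ → refl))) parks)

noSinkEdges-¬sinkTree : ∀ {n} (G : SimpleGraph (suc n)) s → (∀ v → s v ≡ 0) → ∀ π → ¬ IsSinkTree G s π
noSinkEdges-¬sinkTree G s s≗0 π tree = descend (rank zero) zero ≤-refl
  where
  open IsSinkTree tree
  descend : ∀ m v → rank v ≤ m → ⊥
  descend m v rank≤m with lookup π v | valid v | rank-drops v
  ... | inj₂ j | j<sv | _ = n≮0 (subst (j <_) (s≗0 v) j<sv)
  ... | inj₁ u | _    | drops with m
  ...   | zero   = n≮0 (≤-trans drops rank≤m)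
  ...   | suc m′ = descend m′ u (≤-pred (≤-trans drops rank≤m))

parking≈sinkTree : ∀ n (G : SimpleGraph n) s → Equinumerous (IsParking G s) (IsSinkTree G s)
parking≈sinkTree zero G s =
  1 , HasCard-singleton [] (λ { S (() , _) }) (λ { [] → refl })
    , HasCard-singleton [] (record { valid = λ () ; rank = λ () ; rank-drops = λ () }) (λ { [] → refl })
parking≈sinkTree (suc n) G s₀ = below (suc (Σ-fin (suc n) s₀)) s₀ ≤-refl
  where
  below : ∀ f s → Σ-fin (suc n) s < f → Equinumerous (IsParking G s) (IsSinkTree G s)
  below (suc f) s Σs<1+f with any? (λ v → 1 ≤? s v)
  ... | no no-sink-edge =
    0 , HasCard-empty (noSinkEdges-¬parking G s s≗0) , HasCard-empty (noSinkEdges-¬sinkTree G s s≗0)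
    where
    s≗0 : ∀ v → s v ≡ 0
    s≗0 v = n≤0⇒n≡0 (≮⇒≥ (λ 0<sv → no-sink-edge (v , 0<sv)))
  ... | yes (w , 1≤sw) with s w in sw≡ | 1≤sw
  ...   | suc k | _ with below f (dropSinkEdge s w) (subst (_≤ f) Σ-fin-dropSinkEdge (≤-pred Σs<1+f))
                       | parking≈sinkTree n (G ⊖ w) (mergeIntoSink G s w)
    where open ParkingRecursion G s w sw≡
  ...     | k₁ , parking₁ , trees₁ | k₂ , parking₂ , trees₂ =
    k₁ + k₂ , parking-recursion parking₁ parking₂ , sinkTree-recursion trees₁ trees₂
    where
    open ParkingRecursion G s w sw≡
    open SinkTreeRecursion G s w sw≡

-- Spanning trees of the cone

-- The sink of a sink tree becomes the apex of the cone.
coneParent : ∀ {n} → Fin n ⊎ ℕ → Fin (suc n)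
coneParent (inj₁ u) = suc u
coneParent (inj₂ _) = zero

parentEdge : ∀ {n} → ParentMap n → Fin (suc n) → Fin (suc n) → Bool
parentEdge π zero    j = false
parentEdge π (suc v) j = does (coneParent (lookup π v) ≟ j)

treeEdges : ∀ {n} → ParentMap n → EdgeSet (suc n)
treeEdges π = tabulate λ i → tabulate λ j → parentEdge π i j ∨ parentEdge π j i

tadj-treeEdges : ∀ {n} (π : ParentMap n) i j → tadj (treeEdges π) i j ≡ (parentEdge π i j ∨ parentEdge π j i)
tadj-treeEdges π i j =
  trans (cong (λ row → lookup row j) (lookup∘tabulate (λ i → tabulate λ j → parentEdge π i j ∨ parentEdge π j i) i))
        (lookup∘tabulate (λ j → parentEdge π i j ∨ parentEdge π j i) j)

parentEdge-parent : ∀ {n} (π : ParentMap n) v → parentEdge π (suc v) (coneParent (lookup π v)) ≡ true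
parentEdge-parent π v = dec-true (coneParent (lookup π v) ≟ coneParent (lookup π v)) refl

parentEdge⇒parent : ∀ {n} (π : ParentMap n) i j → parentEdge π i j ≡ true →
  ∃ λ v → i ≡ suc v × coneParent (lookup π v) ≡ j
parentEdge⇒parent π (suc v) j e with coneParent (lookup π v) ≟ j
... | yes parent≡j = v , refl , parent≡j

coneAdj-sym : ∀ {n} (G : SimpleGraph n) i j → coneAdj G i j ≡ coneAdj G j i
coneAdj-sym G zero    zero    = refl
coneAdj-sym G zero    (suc j) = refl
coneAdj-sym G (suc i) zero    = refl
coneAdj-sym G (suc i) (suc j) = adj-sym G i j

module FromSinkTree {n} (G : SimpleGraph n) (π : ParentMap n) (tree : IsSinkTree G one π) where

  open IsSinkTree tree

  coneRank : Fin (suc n) → ℕ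
  coneRank zero    = 0
  coneRank (suc v) = suc (rank v)

  coneRank-drops : ∀ v → coneRank (coneParent (lookup π v)) < coneRank (suc v)
  coneRank-drops v with lookup π v | rank-drops v
  ... | inj₁ u | drops = s≤s drops
  ... | inj₂ _ | _     = s≤s z≤n

  parentEdge-rank : ∀ i j → parentEdge π i j ≡ true → coneRank j < coneRank i
  parentEdge-rank i j e with parentEdge⇒parent π i j e
  ... | v , refl , refl = coneRank-drops v

  parentEdge-asym : ∀ i j → parentEdge π i j ≡ true → parentEdge π j i ≡ true → ⊥
  parentEdge-asym i j eij eji = <-asym (parentEdge-rank i j eij) (parentEdge-rank j i eji)

  Edge : Fin (suc n) → Fin (suc n) → Set
  Edge i j = tadj (treeEdges π) i j ≡ true

  edge-sym : ∀ i j → tadj (treeEdges π) i j ≡ tadj (treeEdges π) j i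
  edge-sym i j = trans (tadj-treeEdges π i j) (trans (∨-comm (parentEdge π i j) _) (sym (tadj-treeEdges π j i)))

  toApex : ∀ m i → coneRank i < m → Star Edge i zero
  toApex m       zero    _ = ε
  toApex (suc m) (suc v) (s≤s rank<m) =
    trans (tadj-treeEdges π (suc v) p) (cong (_∨ parentEdge π p (suc v)) (parentEdge-parent π v))
    ◅ toApex m p (≤-trans (coneRank-drops v) rank<m)
    where p = coneParent (lookup π v)

  connected : ∀ i j → Star Edge i j
  connected i j = toApex _ i ≤-refl ◅◅ reverse (λ {a} {b} e → trans (edge-sym b a) e) (toApex _ j ≤-refl)

  parentsOut : Fin (suc n) → ℕ
  parentsOut i = Σ-fin (suc n) (λ j → b2n (parentEdge π i j))

  childrenIn : Fin (suc n) → ℕ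
  childrenIn i = Σ-fin (suc n) (λ j → b2n (parentEdge π j i))

  parentEdgeCount : Σ-fin (suc n) parentsOut ≡ n
  parentEdgeCount =
    cong₂ _+_ (Σ-fin-zero (suc n) (λ _ → refl))
              (trans (Σ-fin-cong n (λ v → Σ-fin-indicator (suc n) (coneParent (lookup π v)))) (Σ-fin-const-1 n))

  edgeCount : orderedEdgeCount (treeEdges π) ≡ 2 * (suc n ∸ 1)
  edgeCount = begin
    orderedEdgeCount (treeEdges π)
      ≡⟨ Σ-fin-cong (suc n) (λ i → Σ-fin-cong (suc n) (b2n-edge i)) ⟩
    Σ-fin (suc n) (λ i → Σ-fin (suc n) (λ j → b2n (parentEdge π i j) + b2n (parentEdge π j i)))
      ≡⟨ Σ-fin-cong (suc n) (λ i →
           Σ-fin-distrib-+ (suc n) (λ j → b2n (parentEdge π i j)) (λ j → b2n (parentEdge π j i))) ⟩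
    Σ-fin (suc n) (λ i → parentsOut i + childrenIn i)
      ≡⟨ Σ-fin-distrib-+ (suc n) parentsOut childrenIn ⟩
    Σ-fin (suc n) parentsOut + Σ-fin (suc n) childrenIn
      ≡⟨ cong₂ _+_ parentEdgeCount
                   (trans (sym (Σ-fin-swap (suc n) (suc n) (λ j i → b2n (parentEdge π j i)))) parentEdgeCount) ⟩
    n + n
      ≡⟨ cong (n +_) (sym (+-identityʳ n)) ⟩
    2 * (suc n ∸ 1) ∎
    where
    open ≡-Reasoning
    b2n-edge : ∀ i j → b2n (tadj (treeEdges π) i j) ≡ b2n (parentEdge π i j) + b2n (parentEdge π j i)
    b2n-edge i j rewrite tadj-treeEdges π i j with parentEdge π i j in eij | parentEdge π j i in eji
    ... | true  | true  = ⊥-elim (parentEdge-asym i j eij eji)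
    ... | true  | false = refl
    ... | false | _     = refl

  parentEdge-inCone : ∀ i j → parentEdge π i j ≡ true → coneAdj G i j ≡ true
  parentEdge-inCone i j e with parentEdge⇒parent π i j e
  ... | v , refl , refl with lookup π v | valid v
  ...   | inj₁ u | vu = vu
  ...   | inj₂ _ | _  = refl

  isSpanningTree : IsSpanningTree (coneAdj G) (treeEdges π)
  isSpanningTree = edge-sym , irreflexive , inCone , connected , edgeCount
    where
    irreflexive : ∀ i → tadj (treeEdges π) i i ≡ false
    irreflexive i with parentEdge π i i in eii
    ... | true  = ⊥-elim (parentEdge-asym i i eii eii)
    ... | false = trans (tadj-treeEdges π i i) (cong (λ b → b ∨ b) eii)
    inCone : ∀ i j → tadj (treeEdges π) i j ≡ true → coneAdj G i j ≡ true
    inCone i j e with parentEdge π i j in eij | parentEdge π j i in eji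
    ... | true  | _    = parentEdge-inCone i j eij
    ... | false | true = trans (coneAdj-sym G i j) (parentEdge-inCone j i eji)
    ... | false | false with () ← trans (sym e) (trans (tadj-treeEdges π i j) (cong₂ _∨_ eij eji))

treeEdges-injective : ∀ {n} (G : SimpleGraph n) → InjectiveOn (IsSinkTree G one) treeEdges
treeEdges-injective G {a} {b} tree-a tree-b Ea≡Eb =
  Vec-ext λ v → sameEntry v (lookup a v) (lookup b v) refl refl (sameParent _ v ≤-refl)
  where
  open IsSinkTree
  open FromSinkTree G a tree-a using (parentEdge-asym; coneRank-drops)
  sameEdges : ∀ i j → (parentEdge a i j ∨ parentEdge a j i) ≡ (parentEdge b i j ∨ parentEdge b j i)
  sameEdges i j = trans (sym (tadj-treeEdges a i j)) (trans (cong (λ E → tadj E i j) Ea≡Eb) (tadj-treeEdges b i j))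
  -- If a and b disagree at v, the a-parent u of v has b-parent v; since u has smaller a-rank,
  -- a and b agree at u by induction, so a contains both u → v and v → u.
  sameParent : ∀ m v → rank tree-a v < m → coneParent (lookup a v) ≡ coneParent (lookup b v)
  sameParent (suc m) v (s≤s rank<m) with coneParent (lookup a v) ≟ coneParent (lookup b v)
  ... | yes same  = same
  ... | no differ with parentEdge⇒parent b p (suc v) b-reversed
    where
    p = coneParent (lookup a v)
    b-reversed : parentEdge b p (suc v) ≡ true
    b-reversed = begin
      parentEdge b p (suc v)
        ≡⟨ cong (_∨ parentEdge b p (suc v)) (sym (dec-false (coneParent (lookup b v) ≟ p) (differ ∘ sym))) ⟩
      parentEdge b (suc v) p ∨ parentEdge b p (suc v)     ≡⟨ sym (sameEdges (suc v) p) ⟩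
      parentEdge a (suc v) p ∨ parentEdge a p (suc v)     ≡⟨ cong (_∨ parentEdge a p (suc v)) (parentEdge-parent a v) ⟩
      true                                                ∎
      where open ≡-Reasoning
  ... | u , p≡u , b-u→v = ⊥-elim (parentEdge-asym (suc v) (suc u)
          (dec-true (coneParent (lookup a v) ≟ suc u) p≡u)
          (dec-true (coneParent (lookup a u) ≟ suc v) (trans (sameParent m u (≤-trans rank-u<v rank<m)) b-u→v)))
    where
    rank-u<v : rank tree-a u < rank tree-a v
    rank-u<v = ≤-pred (subst (λ x → FromSinkTree.coneRank G a tree-a x < suc (rank tree-a v)) p≡u (coneRank-drops v))
  sameEntry : ∀ v x y → lookup a v ≡ x → lookup b v ≡ y → coneParent x ≡ coneParent y → lookup a v ≡ lookup b v
  sameEntry v (inj₁ u) (inj₁ .u) ax by refl = trans ax (sym by)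
  sameEntry v (inj₁ _) (inj₂ _)  _  _  ()
  sameEntry v (inj₂ _) (inj₁ _)  _  _  ()
  sameEntry v (inj₂ i) (inj₂ j)  ax by _ with valid tree-a v | valid tree-b v
  ... | i<1 | j<1 rewrite ax | by = cong inj₂ (trans (n<1⇒n≡0 i<1) (sym (n<1⇒n≡0 j<1)))

least : {P : ℕ → Set} → (∀ k → Dec (P k)) → ∀ {k} → P k → ∃ λ m → P m × (∀ j → j < m → ¬ P j)
least P? {zero} p0 = 0 , p0 , λ _ ()
least {P} P? {suc k} pk with P? 0
... | yes p0 = 0 , p0 , λ _ ()
... | no ¬p0 with least {P ∘ suc} (P? ∘ suc) {k} pk
...   | m , pm , none-below = suc m , pm , λ { zero _ → ¬p0 ; (suc j) j<m → none-below j (≤-pred j<m) }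

module ToSinkTree {n} (G : SimpleGraph n) (T : EdgeSet (suc n)) (spanning : IsSpanningTree (coneAdj G) T) where

  T-sym = proj₁ spanning
  T-inCone = proj₁ (proj₂ (proj₂ spanning))
  T-connected = proj₁ (proj₂ (proj₂ (proj₂ spanning)))
  T-edgeCount = proj₂ (proj₂ (proj₂ (proj₂ spanning)))

  Reach : ℕ → Fin (suc n) → Set
  Reach zero    i = i ≡ zero
  Reach (suc k) i = Reach k i ⊎ ∃ λ j → tadj T i j ≡ true × Reach k j

  reach? : ∀ k i → Dec (Reach k i)
  reach? zero    i = i ≟ zero
  reach? (suc k) i = reach? k i ⊎-dec any? (λ j → (tadj T i j Bool.≟ true) ×-dec reach? k j)

  reach-extend : ∀ {a i} → Star (λ x y → tadj T x y ≡ true) a i → ∀ k → Reach k a → ∃ λ k′ → Reach k′ i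
  reach-extend ε k reach = k , reach
  reach-extend (_◅_ {i = a} {j = b} ab rest) k reach =
    reach-extend rest (suc k) (inj₂ (a , trans (T-sym b a) ab , reach))

  shortest : ∀ i → ∃ λ m → Reach m i × (∀ k → k < m → ¬ Reach k i)
  shortest i = least (λ k → reach? k i) (proj₂ (reach-extend (T-connected zero i) 0 refl))

  level : Fin (suc n) → ℕ
  level i = proj₁ (shortest i)

  level-reach : ∀ i → Reach (level i) i
  level-reach i = proj₁ (proj₂ (shortest i))

  level-min : ∀ i k → Reach k i → level i ≤ k
  level-min i k reach = ≮⇒≥ λ k<level → proj₂ (proj₂ (shortest i)) k k<level reach

  closer : ∀ v → ∃ λ j → tadj T (suc v) j ≡ true × level j < level (suc v)
  closer v = descend (level (suc v)) refl
    where
    descend : ∀ m → level (suc v) ≡ m → ∃ λ j → tadj T (suc v) j ≡ true × level j < level (suc v)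
    descend zero    eq with () ← subst (λ k → Reach k (suc v)) eq (level-reach (suc v))
    descend (suc m) eq with subst (λ k → Reach k (suc v)) eq (level-reach (suc v))
    ... | inj₁ reach = ⊥-elim (<-irrefl eq (s≤s (level-min (suc v) m reach)))
    ... | inj₂ (j , e , reach) = j , e , subst (level j <_) (sym eq) (s≤s (level-min j m reach))

  toEntry : Fin (suc n) → Fin n ⊎ ℕ
  toEntry zero    = inj₂ 0
  toEntry (suc u) = inj₁ u

  π : ParentMap n
  π = tabulate (λ v → toEntry (proj₁ (closer v)))

  π-lookup : ∀ v → lookup π v ≡ toEntry (proj₁ (closer v))
  π-lookup = lookup∘tabulate _

  isSinkTree : IsSinkTree G one π
  isSinkTree = record
    { valid      = λ v → subst (ValidParent G one v) (sym (π-lookup v))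
                           (valid-toEntry v _ (proj₁ (proj₂ (closer v))))
    ; rank       = level ∘ suc
    ; rank-drops = λ v → subst (RankDrops (level ∘ suc) v) (sym (π-lookup v))
                           (drops-toEntry v _ (proj₂ (proj₂ (closer v))))
    }
    where
    valid-toEntry : ∀ v j → tadj T (suc v) j ≡ true → ValidParent G one v (toEntry j)
    valid-toEntry v zero    _ = s≤s z≤n
    valid-toEntry v (suc u) e = T-inCone (suc v) (suc u) e
    drops-toEntry : ∀ v j → level j < level (suc v) → RankDrops (level ∘ suc) v (toEntry j)
    drops-toEntry v zero    _  = tt
    drops-toEntry v (suc u) lt = lt

  parentEdge-inT : ∀ i j → parentEdge π i j ≡ true → tadj T i j ≡ true
  parentEdge-inT i j e with parentEdge⇒parent π i j e
  ... | v , refl , refl rewrite π-lookup v with closer v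
  ...   | zero  , e′ , _ = e′
  ...   | suc u , e′ , _ = e′

  treeEdges≡T : treeEdges π ≡ T
  treeEdges≡T = Vec-ext λ i → Vec-ext λ j → b2n-injective (sameRow i j)
    where
    ⊆T : ∀ i j → b2n (tadj (treeEdges π) i j) ≤ b2n (tadj T i j)
    ⊆T i j with parentEdge π i j in eij | parentEdge π j i in eji
    ... | false | false rewrite tadj-treeEdges π i j | eij | eji = z≤n
    ... | true  | _     rewrite tadj-treeEdges π i j | eij = ≤-reflexive (cong b2n (sym (parentEdge-inT i j eij)))
    ... | false | true  rewrite tadj-treeEdges π i j | eij | eji =
      ≤-reflexive (cong b2n (sym (trans (T-sym i j) (parentEdge-inT j i eji))))
    sameCount : orderedEdgeCount (treeEdges π) ≡ orderedEdgeCount T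
    sameCount = trans (FromSinkTree.edgeCount G π isSinkTree) (sym T-edgeCount)
    sameRow : ∀ i j → b2n (tadj (treeEdges π) i j) ≡ b2n (tadj T i j)
    sameRow i = Σ-fin-≤-≡⇒≡ (suc n) (⊆T i)
      (Σ-fin-≤-≡⇒≡ (suc n) (λ i → Σ-fin-mono-≤ (suc n) (⊆T i)) sameCount i)
    b2n-injective : ∀ {a b} → b2n a ≡ b2n b → a ≡ b
    b2n-injective {true}  {true}  _ = refl
    b2n-injective {false} {false} _ = refl

sinkTrees≈spanningTrees : ∀ {n} (G : SimpleGraph n) {k} → HasCard (IsSinkTree G one) k → NumSpanningTrees (coneAdj G) k
sinkTrees≈spanningTrees G card =
  HasCard-image treeEdges card (treeEdges-injective G) (FromSinkTree.isSpanningTree G)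
    (λ T spanning → let open ToSinkTree G T spanning in π , isSinkTree , treeEdges≡T)

theorem3p1 : (n : ℕ) (G : SimpleGraph n) →
    Σ ℕ λ k → HasCard (RelaxedLegal G) k × NumSpanningTrees (coneAdj G) k
theorem3p1 n G with parking≈sinkTree n G one
... | k , parkings , sinkTrees = k , relaxedLegal≈parking G parkings , sinkTrees≈spanningTrees G sinkTrees
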